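{- Let $G=(V,E)$ be a finite directed acyclic graph whose vertices are the states of a dynamic program, where an edge $j\to i$ means that $j$ is a decision at $i$. Each state $i$ with in-degree zero has a true value given by a boundary condition; every other state $i$ has true value $D^*[i]=\operatorname{opt}_{j:\,(j\to i)\in E} f_{i,j}(D^*[j])$, where $\operatorname{opt}$ is a fixed one of $\min$ or $\max$ and the $f_{i,j}$ are given functions. Run the Cordon Algorithm (described in the context) on this instance. Then whenever a state is marked finalized, its tentative value $D[i]$ equals its true value $D^*[i]$; consequently, when the algorithm terminates, every state holds its true DP value.
   Context: A relaxation of state $i$ by state $j$ (with $j\to i\in E$) replaces $D[i]$ by the better of $D[i]$ and $f_{i,j}(D[j])$, where "better" means smaller if $\operatorname{opt}=\min$ and larger if $\operatorname{opt}=\max$; it is successful if $D[i]$ strictly improves. Initially no state has a value better than its true value, and before any relaxation the tentative value of a non-source state is the worst possible value ($+\infty$ for min, $-\infty$ for max). The Cordon Algorithm proceeds in rounds. Step 1: mark all states tentative and initialize the tentative values $D[\cdot]$ from the boundary condition. Step 2: for every pair of tentative states $j,i$ with $j\to i\in E$ such that $j$ could successfully relax $i$ using its current tentative value, place a sentinel on $i$; a state is ready if it is tentative and no ancestor of it (including itself) in $G$ carries a sentinel. Step 3: every ready state relaxes every state $i$ with an edge from it. Step 4: mark all ready states finalized and remove all sentinels. Step 5: if tentative states remain, return to Step 2. -}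

module Defs where

open import Data.Nat using (ℕ)
open import Data.Fin using (Fin)
open import Data.Bool using (Bool; true; false)
open import Data.Product using (Σ; ∃; ∃-syntax; _×_; _,_)
open import Data.Sum using (_⊎_)
open import Relation.Nullary using (¬_)
open import Relation.Binary.PropositionalEquality using (_≡_)
open import Relation.Binary.Construct.Closure.ReflexiveTransitive using (Star)
open import Relation.Binary.Construct.Closure.Transitive using (TransClosure)

data Opt : Set where
  min max : Opt

data Ext (V : Set) : Set where
  -∞  : Ext V
  [_] : V → Ext V
  +∞  : Ext V

Acyclic : {n : ℕ} → (Fin n → Fin n → Set) → Set
Acyclic {n} E = (i : Fin n) → ¬ TransClosure E i i

betterBy : {A : Set} → Opt → (A → A → Set) → A → A → Set
betterBy min _<'_ x y = x <' y
betterBy max _<'_ x y = y <' x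

worstFor : {V : Set} → Opt → Ext V
worstFor min = +∞
worstFor max = -∞

module Cordon {V : Set} (_<_ : V → V → Set) (o : Opt) {n : ℕ}
              (E : Fin n → Fin n → Set)        -- E j i : edge j → i (j is a decision at i)
              (f : Fin n → Fin n → V → V)
              (b : Fin n → V)
              where

  data _<ᵉ_ : Ext V → Ext V → Set where
    -∞<[] : ∀ {v} → -∞ <ᵉ [ v ]
    -∞<+∞ : -∞ <ᵉ +∞
    []<[] : ∀ {u v} → u < v → [ u ] <ᵉ [ v ]
    []<+∞ : ∀ {v} → [ v ] <ᵉ +∞

  Better : Ext V → Ext V → Set
  Better x y = betterBy o _<ᵉ_ x y

  worst : Ext V
  worst = worstFor o

  -- f_{i,j} applied to a tentative value; the worst value (no value yet)
  -- is mapped to the worst value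
  app : Fin n → Fin n → Ext V → Ext V
  app i j [ v ] = [ f i j v ]
  app i j -∞    = worst
  app i j +∞    = worst

  Source : Fin n → Set
  Source i = (j : Fin n) → ¬ E j i

  TrueValues : (Fin n → V) → Set
  TrueValues Dstar = (i : Fin n) →
      (Source i → Dstar i ≡ b i)
    × (¬ Source i →
         (∃[ j ] (E j i × Dstar i ≡ f i j (Dstar j)))
       × ((j : Fin n) → E j i → ¬ Better [ f i j (Dstar j) ] [ Dstar i ]))

  record AState : Set where
    constructor mkState
    field
      final : Fin n → Bool
      D     : Fin n → Ext V
  open AState public

  value : AState → Fin n → Ext V
  value s i = D s i

  Tentative : AState → Fin n → Set
  Tentative s i = final s i ≡ false

  Finalized : AState → Fin n → Set
  Finalized s i = final s i ≡ true

  IsInit : AState → Set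
  IsInit s = (i : Fin n) →
      Tentative s i
    × (Source i → D s i ≡ [ b i ])
    × (¬ Source i → D s i ≡ worst)

  SuccRelax : AState → Fin n → Fin n → Set
  SuccRelax s j i = Better (app i j (D s j)) (D s i)

  Sentinel : AState → Fin n → Set
  Sentinel s i = Tentative s i ×
    (∃[ j ] (Tentative s j × E j i × SuccRelax s j i))

  Ready : AState → Fin n → Set
  Ready s i = Tentative s i × ((a : Fin n) → Star E a i → ¬ Sentinel s a)

  Cand : AState → Fin n → Ext V → Set
  Cand s i c = (c ≡ D s i) ⊎ (∃[ j ] (Ready s j × E j i × c ≡ app i j (D s j)))

  IsRelaxed : AState → Fin n → Ext V → Set
  IsRelaxed s i x = Cand s i x × ((c : Ext V) → Cand s i c → ¬ Better c x)

  -- one round (Steps 2-4): s' is the state after the round started in s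
  Round : AState → AState → Set
  Round s s' = (i : Fin n) →
      ((Finalized s' i → Finalized s i ⊎ Ready s i)
     × (Finalized s i ⊎ Ready s i → Finalized s' i))
    × IsRelaxed s i (D s' i)

  data Reach : AState → Set where
    init : ∀ {s} → IsInit s → Reach s
    step : ∀ {s s'} → Reach s → (∃[ i ] Tentative s i) → Round s s' → Reach s'

-- Every reachable state of the algorithm satisfies an invariant: no tentative
-- value is better than the true one, finalized states hold their true values
-- and have already relaxed their successors with them, and sources are exact.
-- Rounds preserve it because ready states are exact: if a ready state were
-- overestimated, an optimal decision of any overestimated ancestor would be an
-- overestimated ancestor as well (otherwise it would have relaxed it, or put a
-- sentinel above the ready state), giving an endless backward walk in a finite
-- acyclic graph.
module Submission where

open import Defs
open import Data.Nat using (ℕ; zero; suc; s≤s) renaming (_<_ to _<ℕ_)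
open import Data.Nat.Properties using (m≤n⇒m<n∨m≡n; n<1+n)
open import Data.Fin using (Fin; toℕ)
open import Data.Fin.Properties using (pigeonhole)
open import Data.Bool using (true; false)
open import Data.Empty using (⊥)
open import Data.Sum using (_⊎_; inj₁; inj₂)
open import Data.Product using (Σ; ∃-syntax; _×_; _,_; proj₁; proj₂)
open import Function using (_∘_)
open import Level using (0ℓ)
open import Relation.Nullary using (¬_; contradiction)
open import Relation.Binary.Core using (Rel)
open import Relation.Binary.PropositionalEquality
  using (_≡_; refl; sym; trans; cong; subst; isEquivalence)
open import Relation.Binary.Structures using (IsStrictTotalOrder)
open import Relation.Binary.Structures.Biased using (isStrictTotalOrderᶜ)
open import Relation.Binary.Definitions using (Tri; tri<; tri≈; tri>)
open import Relation.Binary.Construct.Closure.ReflexiveTransitive using (Star; ε; _◅_)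
open import Relation.Binary.Construct.Closure.Transitive using (TransClosure; [_]; _∷_)
import Relation.Binary.Construct.Flip.EqAndOrd as Flip

module _ {n : ℕ} (E : Fin n → Fin n → Set) where

  NoMinimal : (Fin n → Set) → Set
  NoMinimal P = ∀ {a} → P a → ∃[ j ] (E j a × P j)

  -- Following predecessors inside P yields an infinite backward walk; by the
  -- pigeonhole principle some vertex repeats, which closes a cycle.
  acyclic⇒NoMinimal⇒empty : Acyclic E → (P : Fin n → Set) → NoMinimal P →
                            ∀ {a} → ¬ P a
  acyclic⇒NoMinimal⇒empty acyclic P noMinimal {a} pa = cycle
    where
      walk : ℕ → Σ (Fin n) P
      walk zero    = a , pa
      walk (suc k) = let j , _ , pj = noMinimal (proj₂ (walk k)) in j , pj

      vertex : ℕ → Fin n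
      vertex = proj₁ ∘ walk

      walk-edge : ∀ k → E (vertex (suc k)) (vertex k)
      walk-edge k = proj₁ (proj₂ (noMinimal (proj₂ (walk k))))

      walk-path : ∀ {m k} → m <ℕ k → TransClosure E (vertex k) (vertex m)
      walk-path {m} {suc k} (s≤s m≤k) with m≤n⇒m<n∨m≡n m≤k
      ... | inj₁ m<k  = walk-edge k ∷ walk-path m<k
      ... | inj₂ refl = [ walk-edge k ]

      cycle : ⊥
      cycle with pigeonhole (n<1+n n) (vertex ∘ toℕ)
      ... | x , y , x<y , same = acyclic (vertex (toℕ x))
              (subst (λ v → TransClosure E v (vertex (toℕ x))) (sym same) (walk-path x<y))

module _ {A : Set} {_<_ : Rel A 0ℓ} (sto : IsStrictTotalOrder _≡_ _<_) where
  open IsStrictTotalOrder sto using (compare) renaming (trans to <-trans)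

  ≮-trans : ∀ {x y z} → ¬ x < y → ¬ y < z → ¬ x < z
  ≮-trans {x} {y} x≮y y≮z x<z with compare x y
  ... | tri< x<y _ _ = x≮y x<y
  ... | tri≈ _ refl _ = y≮z x<z
  ... | tri> _ _ y<x = y≮z (<-trans y<x x<z)

  ≮-antisym : ∀ {x y} → ¬ x < y → ¬ y < x → x ≡ y
  ≮-antisym {x} {y} x≮y y≮x with compare x y
  ... | tri< x<y _ _ = contradiction x<y x≮y
  ... | tri≈ _ x≡y _ = x≡y
  ... | tri> _ _ y<x = contradiction y<x y≮x

betterBy-isStrictTotalOrder : ∀ {A : Set} {R : Rel A 0ℓ} (o : Opt) →
  IsStrictTotalOrder _≡_ R → IsStrictTotalOrder _≡_ (betterBy o R)
betterBy-isStrictTotalOrder min sto = sto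
betterBy-isStrictTotalOrder max sto = Flip.isStrictTotalOrder sto

worstFor-isWorst : ∀ {V : Set} {R : Rel (Ext V) 0ℓ} (o : Opt) →
  (∀ {x} → ¬ R +∞ x) → (∀ {x} → ¬ R x -∞) → ∀ {y} → ¬ betterBy o R (worstFor o) y
worstFor-isWorst min +∞-maximal _ = +∞-maximal
worstFor-isWorst max _ -∞-minimal = -∞-minimal

module CordonCorrectness
  {V : Set} (_<_ : V → V → Set) (<-sto : IsStrictTotalOrder _≡_ _<_)
  (o : Opt) {n : ℕ} (E : Fin n → Fin n → Set) (acyclic : Acyclic E)
  (f : Fin n → Fin n → V → V) (b : Fin n → V) (Dstar : Fin n → V)
  (trueValues : Cordon.TrueValues _<_ o E f b Dstar)
  where

  open Cordon _<_ o E f b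
  open IsStrictTotalOrder <-sto using () renaming (compare to <-compare)

  <ᵉ-compare : ∀ x y → Tri (x <ᵉ y) (x ≡ y) (y <ᵉ x)
  <ᵉ-compare -∞    -∞    = tri≈ (λ ()) refl (λ ())
  <ᵉ-compare -∞    [ _ ] = tri< -∞<[] (λ ()) (λ ())
  <ᵉ-compare -∞    +∞    = tri< -∞<+∞ (λ ()) (λ ())
  <ᵉ-compare [ _ ] -∞    = tri> (λ ()) (λ ()) -∞<[]
  <ᵉ-compare [ x ] [ y ] with <-compare x y
  ... | tri< x<y x≢y x≯y = tri< ([]<[] x<y) (λ { refl → x≢y refl }) (λ { ([]<[] y<x) → x≯y y<x })
  ... | tri≈ x≮y x≡y x≯y = tri≈ (λ { ([]<[] x<y) → x≮y x<y }) (cong [_] x≡y) (λ { ([]<[] y<x) → x≯y y<x })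
  ... | tri> x≮y x≢y y<x = tri> (λ { ([]<[] x<y) → x≮y x<y }) (λ { refl → x≢y refl }) ([]<[] y<x)
  <ᵉ-compare [ _ ] +∞    = tri< []<+∞ (λ ()) (λ ())
  <ᵉ-compare +∞    -∞    = tri> (λ ()) (λ ()) -∞<+∞
  <ᵉ-compare +∞    [ _ ] = tri> (λ ()) (λ ()) []<+∞
  <ᵉ-compare +∞    +∞    = tri≈ (λ ()) refl (λ ())

  <ᵉ-trans : ∀ {x y z} → x <ᵉ y → y <ᵉ z → x <ᵉ z
  <ᵉ-trans -∞<[]       ([]<[] _) = -∞<[]
  <ᵉ-trans -∞<[]       []<+∞     = -∞<+∞
  <ᵉ-trans ([]<[] x<y) ([]<[] y<z) = []<[] (IsStrictTotalOrder.trans <-sto x<y y<z)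
  <ᵉ-trans ([]<[] _)   []<+∞     = []<+∞

  <ᵉ-isStrictTotalOrder : IsStrictTotalOrder _≡_ _<ᵉ_
  <ᵉ-isStrictTotalOrder = isStrictTotalOrderᶜ record
    { isEquivalence = isEquivalence ; trans = <ᵉ-trans ; compare = <ᵉ-compare }

  Better-isStrictTotalOrder : IsStrictTotalOrder _≡_ Better
  Better-isStrictTotalOrder = betterBy-isStrictTotalOrder o <ᵉ-isStrictTotalOrder

  open IsStrictTotalOrder Better-isStrictTotalOrder using () renaming
    (compare to compareBetter; irrefl to Better-irrefl)

  worst-isWorst : ∀ {y} → ¬ Better worst y
  worst-isWorst = worstFor-isWorst o (λ ()) (λ ())

  source-value : ∀ {i} → Source i → Dstar i ≡ b i
  source-value {i} = proj₁ (trueValues i)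

  optimal-decision : ∀ {i} → ¬ Source i → ∃[ j ] (E j i × Dstar i ≡ f i j (Dstar j))
  optimal-decision {i} = proj₁ ∘ proj₂ (trueValues i)

  decision-not-better : ∀ {j i} → E j i → ¬ Better [ f i j (Dstar j) ] [ Dstar i ]
  decision-not-better {j} {i} j→i = proj₂ (proj₂ (trueValues i) (λ source → source j j→i)) j j→i

  finalized-or-tentative : ∀ s i → Finalized s i ⊎ Tentative s i
  finalized-or-tentative s i with final s i
  ... | true  = inj₁ refl
  ... | false = inj₂ refl

  finalized-not-tentative : ∀ {s i} → Finalized s i → ¬ Tentative s i
  finalized-not-tentative fin tent with trans (sym fin) tent
  ... | ()

  Overestimated : AState → Fin n → Set
  Overestimated s i = Better [ Dstar i ] (D s i)

  exact⇒¬overestimated : ∀ {s a} → D s a ≡ [ Dstar a ] → ¬ Overestimated s a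
  exact⇒¬overestimated exact = Better-irrefl (sym exact)

  record Sound (s : AState) : Set where
    field
      finalized-exact      : ∀ {i} → Finalized s i → D s i ≡ [ Dstar i ]
      not-better-than-true : ∀ i → ¬ Better (D s i) [ Dstar i ]
      finalized-relaxed    : ∀ {j i} → Finalized s j → E j i → ¬ Better [ f i j (Dstar j) ] (D s i)
      source-exact         : ∀ {i} → Source i → D s i ≡ [ Dstar i ]

  init-sound : ∀ {s} → IsInit s → Sound s
  init-sound {s} isInit = record
    { finalized-exact      = λ {i} fin → contradiction (tentative i) (finalized-not-tentative {s} fin)
    ; not-better-than-true = not-better
    ; finalized-relaxed    = λ {j} fin _ → contradiction (tentative j) (finalized-not-tentative {s} fin)
    ; source-exact         = source-exact
    }
    where
      tentative : ∀ i → Tentative s i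
      tentative i = proj₁ (isInit i)

      source-exact : ∀ {i} → Source i → D s i ≡ [ Dstar i ]
      source-exact {i} source = trans (proj₁ (proj₂ (isInit i)) source) (cong [_] (sym (source-value source)))

      not-better : ∀ i → ¬ Better (D s i) [ Dstar i ]
      not-better i better = worst-isWorst (subst (λ x → Better x [ Dstar i ]) starts-worst better)
        where
          starts-worst : D s i ≡ worst
          starts-worst = proj₂ (proj₂ (isInit i)) (λ source → Better-irrefl (source-exact source) better)

  module _ {s : AState} (sound : Sound s) where
    open Sound sound

    overestimated-ancestor-has-overestimated-parent : ∀ {i} → Ready s i →
      NoMinimal E (λ a → Star E a i × Overestimated s a)
    overestimated-ancestor-has-overestimated-parent (_ , noSentinel) {a} (a→*i , over)
      with finalized-or-tentative s a
    ... | inj₁ a-fin = contradiction over (exact⇒¬overestimated {s} (finalized-exact a-fin))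
    ... | inj₂ a-tent
      with optimal-decision (λ source → exact⇒¬overestimated {s} (source-exact source) over)
    ... | j , j→a , a-via-j
      with compareBetter (D s j) [ Dstar j ] | finalized-or-tentative s j
    ... | tri< better _ _ | _ = contradiction better (not-better-than-true j)
    ... | tri> _ _ j-over | _ = j , j→a , j→a ◅ a→*i , j-over
    ... | tri≈ _ j-exact _ | inj₁ j-fin =
      contradiction (subst (λ v → Better [ v ] (D s a)) a-via-j over) (finalized-relaxed j-fin j→a)
    ... | tri≈ _ j-exact _ | inj₂ j-tent =
      contradiction (a-tent , j , j-tent , j→a , j-relaxes-a) (noSentinel a a→*i)
      where
        j-relaxes-a : SuccRelax s j a
        j-relaxes-a rewrite j-exact = subst (λ v → Better [ v ] (D s a)) a-via-j over

    ready⇒exact : ∀ {i} → Ready s i → D s i ≡ [ Dstar i ]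
    ready⇒exact {i} ready = ≮-antisym Better-isStrictTotalOrder (not-better-than-true i)
      (λ over → acyclic⇒NoMinimal⇒empty E acyclic _
                  (overestimated-ancestor-has-overestimated-parent ready) (ε , over))

    settled⇒exact : ∀ {i} → Finalized s i ⊎ Ready s i → D s i ≡ [ Dstar i ]
    settled⇒exact (inj₁ fin)   = finalized-exact fin
    settled⇒exact (inj₂ ready) = ready⇒exact ready

    candidate-not-better : ∀ {i c} → Cand s i c → ¬ Better c [ Dstar i ]
    candidate-not-better {i} (inj₁ refl) = not-better-than-true i
    candidate-not-better (inj₂ (j , ready , j→i , refl)) rewrite ready⇒exact ready =
      decision-not-better j→i

    round-sound : ∀ {s'} → Round s s' → Sound s'
    round-sound {s'} round = record
      { finalized-exact      = finalized-exact'
      ; not-better-than-true = not-better'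
      ; finalized-relaxed    = finalized-relaxed'
      ; source-exact         = source-exact'
      }
      where
        settled : ∀ {i} → Finalized s' i → Finalized s i ⊎ Ready s i
        settled {i} = proj₁ (proj₁ (round i))

        relaxed : ∀ i → IsRelaxed s i (D s' i)
        relaxed i = proj₂ (round i)

        not-worse : ∀ i → ¬ Better (D s i) (D s' i)
        not-worse i = proj₂ (relaxed i) (D s i) (inj₁ refl)

        not-better' : ∀ i → ¬ Better (D s' i) [ Dstar i ]
        not-better' i = candidate-not-better (proj₁ (relaxed i))

        finalized-exact' : ∀ {i} → Finalized s' i → D s' i ≡ [ Dstar i ]
        finalized-exact' {i} fin = ≮-antisym Better-isStrictTotalOrder (not-better' i)
          (subst (λ x → ¬ Better x (D s' i)) (settled⇒exact (settled fin)) (not-worse i))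

        finalized-relaxed' : ∀ {j i} → Finalized s' j → E j i → ¬ Better [ f i j (Dstar j) ] (D s' i)
        finalized-relaxed' {j} {i} fin j→i with settled fin
        ... | inj₁ j-fin   = ≮-trans Better-isStrictTotalOrder (finalized-relaxed j-fin j→i) (not-worse i)
        ... | inj₂ j-ready = subst (λ x → ¬ Better (app i j x) (D s' i)) (ready⇒exact j-ready)
                               (proj₂ (relaxed i) _ (inj₂ (j , j-ready , j→i , refl)))

        source-exact' : ∀ {i} → Source i → D s' i ≡ [ Dstar i ]
        source-exact' {i} source with proj₁ (relaxed i)
        ... | inj₁ unchanged          = trans unchanged (source-exact source)
        ... | inj₂ (j , _ , j→i , _) = contradiction j→i (source j)

  reachable-sound : ∀ {s} → Reach s → Sound s
  reachable-sound (init isInit)         = init-sound isInit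
  reachable-sound (step reach _ round) = round-sound (reachable-sound reach) round

mainTheorem1 : {V : Set} (_<_ : V → V → Set) → IsStrictTotalOrder _≡_ _<_ →
    (o : Opt) (n : ℕ) (E : Fin n → Fin n → Set) → Acyclic E →
    (f : Fin n → Fin n → V → V) (b : Fin n → V) (Dstar : Fin n → V) →
    Cordon.TrueValues _<_ o E f b Dstar →
    (s : Cordon.AState _<_ o E f b) → Cordon.Reach _<_ o E f b s →
      ((i : Fin n) → Cordon.Finalized _<_ o E f b s i →
         Cordon.value _<_ o E f b s i ≡ [ Dstar i ])
    × (((i : Fin n) → Cordon.Finalized _<_ o E f b s i) →
         (i : Fin n) → Cordon.value _<_ o E f b s i ≡ [ Dstar i ])
mainTheorem1 _<_ <-sto o n E acyclic f b Dstar trueValues s reach =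
  (λ i → finalized-exact) , (λ allFinalized i → finalized-exact (allFinalized i))
  where
    open CordonCorrectness _<_ <-sto o E acyclic f b Dstar trueValues
    open Sound (reachable-sound reach)
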